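{- For all states $p,q$ of an LTS with inputs and outputs, $p\mathrel{\mathsf{iocos}_\equiv} q$ holds if and only if for every $\phi\in\widetilde{\mathcal L}_{\mathsf{iocos}}$, $p\models\phi$ iff $q\models\phi$.
   Context: Actions: disjoint finite sets $I$ (inputs $a?$) and $O$ (outputs $a!$, including quiescence $\delta!$). An LTS with inputs and outputs is $(S,I,O,\to)$ with $\to\subseteq S\times(I\cup O)\times S$ such that $p\xrightarrow{\delta!}p'$ iff $p=p'$ and $p$ has no $a!$-transition for $a!\in O\setminus\{\delta!\}$; LTSs are image-finite. $\mathsf{ins}(p)$ is the set of inputs $a?$ such that $p$ has an $a?$-transition. A relation $R$ is an iocos-relation if for every $(p,q)\in R$: (1) $\mathsf{ins}(q)\subseteq\mathsf{ins}(p)$; (2) for every $a?\in\mathsf{ins}(q)$ and $p\xrightarrow{a?}p'$ there is $q\xrightarrow{a?}q'$ with $(p',q')\in R$; (3) for every $a!\in O$ and $p\xrightarrow{a!}p'$ there is $q\xrightarrow{a!}q'$ with $(p',q')\in R$. $\mathsf{iocos}$ is the union of all iocos-relations, and $p\mathrel{\mathsf{iocos}_\equiv}q$ means $p\mathrel{\mathsf{iocos}}q$ and $q\mathrel{\mathsf{iocos}}p$. The logic $\widetilde{\mathcal L}_{\mathsf{iocos}}$: $\phi::=\mathrm{tt}\mid\mathrm{ff}\mid\phi\wedge\phi\mid\phi\vee\phi\mid[\![a?]\!]\phi\mid[a!]\phi$, where $p\models[a!]\phi$ iff all $a!$-successors of $p$ satisfy $\phi$, and $p\models[\![a?]\!]\phi$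 iff $p$ has at least one $a?$-transition and all $a?$-successors satisfy $\phi$. -}

module Defs where

open import Level using (0ℓ)
open import Data.List using (List)
open import Data.List.Membership.Propositional using (_∈_)
open import Data.Product using (Σ; ∃; _×_; _,_)
open import Data.Sum using (_⊎_; inj₁; inj₂)
open import Data.Empty using (⊥)
open import Relation.Nullary using (¬_)
open import Relation.Binary.PropositionalEquality using (_≡_; _≢_)
open import Function.Bundles using (_⇔_)

-- Action signature: finite sets of inputs I and outputs O (containing δ!).
-- Disjointness of I and O is built in by taking actions to be I ⊎ O.
record ActSig : Set₁ where
  field
    In       : Set
    Out      : Set
    δ        : Out
    inList   : List In
    inAll    : ∀ a → a ∈ inList
    outList  : List Out
    outAll   : ∀ a → a ∈ outList

record LTS (A : ActSig) : Set₁ where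
  open ActSig A
  field
    State : Set
    _—_⟶_ : State → In ⊎ Out → State → Set
    quiescence : ∀ p p' →
      (p — inj₂ δ ⟶ p') ⇔ ((p ≡ p') × (∀ (a : Out) (p'' : State) → a ≢ δ → ¬ (p — inj₂ a ⟶ p'')))
    imageFinite : ∀ p α → Σ (List State) λ l → ∀ p' → (p — α ⟶ p') ⇔ (p' ∈ l)

module _ {A : ActSig} (L : LTS A) where
  open ActSig A
  open LTS L

  ins : State → In → Set
  ins p a = ∃ λ p' → p — inj₁ a ⟶ p'

  record IsIocosRel (R : State → State → Set) : Set where
    field
      insIncl : ∀ {p q} → R p q → ∀ a → ins q a → ins p a
      inStep  : ∀ {p q} → R p q → ∀ a → ins q a → ∀ {p'} → p — inj₁ a ⟶ p' →
                ∃ λ q' → (q — inj₁ a ⟶ q') × R p' q'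
      outStep : ∀ {p q} → R p q → ∀ (a : Out) {p'} → p — inj₂ a ⟶ p' →
                ∃ λ q' → (q — inj₂ a ⟶ q') × R p' q'

  iocos : State → State → Set₁
  iocos p q = ∃ λ (R : State → State → Set) → IsIocosRel R × R p q

  iocos≡ : State → State → Set₁
  iocos≡ p q = iocos p q × iocos q p

data Form (A : ActSig) : Set where
  tt ff      : Form A
  _∧_ _∨_    : Form A → Form A → Form A
  [[_]]_     : ActSig.In A → Form A → Form A
  [_]_       : ActSig.Out A → Form A → Form A

module _ {A : ActSig} (L : LTS A) where
  open LTS L

  _⊨_ : State → Form A → Set
  p ⊨ tt = Data.Unit.⊤ where import Data.Unit
  p ⊨ ff = ⊥
  p ⊨ (φ ∧ ψ) = (p ⊨ φ) × (p ⊨ ψ)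
  p ⊨ (φ ∨ ψ) = (p ⊨ φ) ⊎ (p ⊨ ψ)
  p ⊨ ([[ a ]] φ) = ins L p a × (∀ p' → p — inj₁ a ⟶ p' → p' ⊨ φ)
  p ⊨ ([ a ] φ) = ∀ p' → p — inj₂ a ⟶ p' → p' ⊨ φ

-- Soundness: formulas are preserved backwards along any iocos-relation, by
-- induction on the formula. Completeness: the logical preorder
-- "every formula true at q is true at p" is itself an iocos-relation. If a
-- move p —α⟶ p' could not be matched, then by image-finiteness q has finitely
-- many α-successors, each refuting p' on some formula; their disjunction φ
-- gives a formula [α]φ (or [[α]]φ) true at q but false at p. Classical logic
-- is used only to obtain these distinguishing formulas.
module Submission where

open import Defs
open import Level using (0ℓ)
open import Axiom.ExcludedMiddle using (ExcludedMiddle)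
open import Function.Bundles using (_⇔_; mk⇔; Equivalence)
open import Data.List using (List; []; _∷_)
open import Data.List.Membership.Propositional using (find)
open import Data.List.Relation.Unary.Any using (Any; here; there)
open import Data.List.Relation.Unary.All as All using (All; []; _∷_)
open import Data.Product using (∃; _×_; _,_; proj₁; proj₂)
open import Data.Sum using (_⊎_; inj₁; inj₂)
open import Data.Empty using (⊥-elim)
open import Relation.Nullary using (¬_; yes; no)

module _ {A : ActSig} (L : LTS A) where
  open ActSig A
  open LTS L

  private
    _⊨′_ : State → Form A → Set
    _⊨′_ = _⊨_ L

  _⊑ᴸ_ : State → State → Set
  p ⊑ᴸ q = ∀ φ → q ⊨′ φ → p ⊨′ φ

  Distinguishes : Form A → State → State → Set
  Distinguishes φ p q = q ⊨′ φ × ¬ p ⊨′ φ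

  IsIocosRel⇒⊑ᴸ : ∀ {R} → IsIocosRel L R → ∀ {p q} → R p q → p ⊑ᴸ q
  IsIocosRel⇒⊑ᴸ isR r tt          h       = h
  IsIocosRel⇒⊑ᴸ isR r (φ ∧ ψ)     (h , k) = IsIocosRel⇒⊑ᴸ isR r φ h , IsIocosRel⇒⊑ᴸ isR r ψ k
  IsIocosRel⇒⊑ᴸ isR r (φ ∨ ψ)     (inj₁ h) = inj₁ (IsIocosRel⇒⊑ᴸ isR r φ h)
  IsIocosRel⇒⊑ᴸ isR r (φ ∨ ψ)     (inj₂ h) = inj₂ (IsIocosRel⇒⊑ᴸ isR r ψ h)
  IsIocosRel⇒⊑ᴸ isR r ([[ a ]] φ) (i , h) =
    IsIocosRel.insIncl isR r a i , λ p' t →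
      let q' , t' , r' = IsIocosRel.inStep isR r a i t in IsIocosRel⇒⊑ᴸ isR r' φ (h q' t')
  IsIocosRel⇒⊑ᴸ isR r ([ a ] φ)   h p' t =
    let q' , t' , r' = IsIocosRel.outStep isR r a t in IsIocosRel⇒⊑ᴸ isR r' φ (h q' t')

  iocos⇒⊑ᴸ : ∀ {p q} → iocos L p q → p ⊑ᴸ q
  iocos⇒⊑ᴸ (_ , isR , r) = IsIocosRel⇒⊑ᴸ isR r

  module _ (em : ExcludedMiddle 0ℓ) where

    ⊑ᴸ-or-distinguished : ∀ p q → p ⊑ᴸ q ⊎ ∃ λ φ → Distinguishes φ p q
    ⊑ᴸ-or-distinguished p q with em {∃ λ φ → Distinguishes φ p q}
    ... | yes d  = inj₂ d
    ... | no ¬d  = inj₁ transfer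
      where
      transfer : ∀ φ → q ⊨′ φ → p ⊨′ φ
      transfer φ h with em {p ⊨′ φ}
      ... | yes x = x
      ... | no ¬x = ⊥-elim (¬d (φ , h , ¬x))

    ⊑ᴸ-some-or-separated : ∀ p (qs : List State) →
      Any (p ⊑ᴸ_) qs ⊎ ∃ λ φ → All (_⊨′ φ) qs × ¬ p ⊨′ φ
    ⊑ᴸ-some-or-separated p []       = inj₂ (ff , [] , λ ())
    ⊑ᴸ-some-or-separated p (q ∷ qs) with ⊑ᴸ-or-distinguished p q | ⊑ᴸ-some-or-separated p qs
    ... | inj₁ p⊑q            | _                    = inj₁ (here p⊑q)
    ... | inj₂ _              | inj₁ any             = inj₁ (there any)
    ... | inj₂ (φ , q⊨φ , ¬φ) | inj₂ (ψ , qs⊨ψ , ¬ψ) =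
      inj₂ (φ ∨ ψ , inj₁ q⊨φ ∷ All.map inj₂ qs⊨ψ , λ { (inj₁ h) → ¬φ h ; (inj₂ h) → ¬ψ h })

    matched-or-separated : ∀ q α p' →
      (∃ λ q' → (q — α ⟶ q') × p' ⊑ᴸ q') ⊎
      (∃ λ φ → (∀ q' → q — α ⟶ q' → q' ⊨′ φ) × ¬ p' ⊨′ φ)
    matched-or-separated q α p' with imageFinite q α
    ... | qs , succ with ⊑ᴸ-some-or-separated p' qs
    ...   | inj₁ any = let q' , q'∈qs , p'⊑q' = find any
                       in inj₁ (q' , Equivalence.from (succ q') q'∈qs , p'⊑q')
    ...   | inj₂ (φ , qs⊨φ , ¬φ) =
            inj₂ (φ , (λ q' t → All.lookup qs⊨φ (Equivalence.to (succ q') t)) , ¬φ)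

    ⊑ᴸ-isIocosRel : IsIocosRel L _⊑ᴸ_
    IsIocosRel.insIncl ⊑ᴸ-isIocosRel p⊑q a i = proj₁ (p⊑q ([[ a ]] tt) (i , _))
    IsIocosRel.inStep ⊑ᴸ-isIocosRel {q = q} p⊑q a i {p'} t with matched-or-separated q (inj₁ a) p'
    ... | inj₁ match          = match
    ... | inj₂ (φ , q⊨ , ¬φ) = ⊥-elim (¬φ (proj₂ (p⊑q ([[ a ]] φ) (i , q⊨)) p' t))
    IsIocosRel.outStep ⊑ᴸ-isIocosRel {q = q} p⊑q a {p'} t with matched-or-separated q (inj₂ a) p'
    ... | inj₁ match          = match
    ... | inj₂ (φ , q⊨ , ¬φ) = ⊥-elim (¬φ (p⊑q ([ a ] φ) q⊨ p' t))

    iocos⇔⊑ᴸ : ∀ {p q} → iocos L p q ⇔ p ⊑ᴸ q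
    iocos⇔⊑ᴸ = mk⇔ iocos⇒⊑ᴸ λ p⊑q → _⊑ᴸ_ , ⊑ᴸ-isIocosRel , p⊑q

corollary3 : ExcludedMiddle 0ℓ → (A : ActSig) (L : LTS A) (p q : LTS.State L) →
    iocos≡ L p q ⇔ (∀ (φ : Form A) → (_⊨_ L p φ) ⇔ (_⊨_ L q φ))
corollary3 em A L p q = mk⇔
  (λ (pq , qp) φ → mk⇔ (iocos⇒⊑ᴸ L qp φ) (iocos⇒⊑ᴸ L pq φ))
  (λ p≡q → ⊑ᴸ⇒iocos (λ φ → Equivalence.from (p≡q φ)) , ⊑ᴸ⇒iocos (λ φ → Equivalence.to (p≡q φ)))
  where
  ⊑ᴸ⇒iocos : ∀ {p q} → _⊑ᴸ_ L p q → iocos L p q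
  ⊑ᴸ⇒iocos = Equivalence.from (iocos⇔⊑ᴸ L em)
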